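{- For every positive integer $n$ and every integer $k\ge 8$, $|Q(n,k)|\ge 2^{\lfloor k/4\rfloor^n}$.
   Context: For a nonempty set $\Sigma$ and a positive integer $n$, an $n$-ary operation $f:\Sigma^n\to\Sigma$ is an $n$-quasigroup if in the equality $z_0=f(z_1,\ldots,z_n)$ knowledge of any $n$ of the elements $z_0,\ldots,z_n$ uniquely specifies the remaining one. $Q(n,k)$ denotes the set of all $n$-quasigroups $\Sigma^n\to\Sigma$ on a fixed set $\Sigma$ with $|\Sigma|=k$. -}

module Defs where

open import Data.Nat using (ℕ; _^_; _/_)
open import Data.Fin using (Fin)
open import Data.Product using (∃!; Σ; _×_; proj₁)
open import Data.Vec.Functional using (Vector; updateAt)
open import Function using (const)
open import Relation.Binary.PropositionalEquality using (_≡_)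

-- The alphabet Σ with |Σ| = k is taken to be Fin k.
-- An n-ary operation Σ^n → Σ.
Op : ℕ → ℕ → Set
Op n k = Vector (Fin k) n → Fin k

-- f is an n-quasigroup: in z₀ = f(z₁,…,zₙ), knowing z₀ and all zⱼ (j ≠ i)
-- determines zᵢ uniquely (it exists and is unique). The case where z₀ is
-- the unknown is automatic since f is a function.
IsQuasigroup : ∀ {n k} → Op n k → Set
IsQuasigroup {n} {k} f =
  (i : Fin n) (x : Vector (Fin k) n) (z₀ : Fin k) →
  ∃! _≡_ (λ (a : Fin k) → f (updateAt x i (const a)) ≡ z₀)

Q : ℕ → ℕ → Set
Q n k = Σ (Op n k) IsQuasigroup

-- Two operations are the same element of Q(n,k) iff they agree pointwise.
_≗Op_ : ∀ {n k} → Op n k → Op n k → Set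
f ≗Op g = ∀ x → f x ≡ g x

-- |Q(n,k)| ≥ m : there are m pairwise distinct n-quasigroups,
-- i.e. an injection Fin m → Q(n,k) (up to pointwise equality).
AtLeast : ℕ → ℕ → ℕ → Set
AtLeast m n k =
  Σ (Fin m → Q n k) λ q →
    ∀ (i j : Fin m) → proj₁ (q i) ≗Op proj₁ (q j) → i ≡ j

-- A quasigroup of order k containing the cyclic group ℤ/2M as a subquasigroup yields the
-- n-quasigroup x₁ ∙ (x₂ ∙ (⋯ ∙ xₙ)).  On arguments from ℤ/2M it commutes in each argument with the
-- half-turn σ a = a + M, which has no fixed points and whose orbits are the M blocks {a, a + M}.
-- Hence composing with σ on any union of the M^n products of blocks (switching) still gives an
-- n-quasigroup, and the 2^(M^n) unions give pairwise distinct ones.  For even k take ℤ/k itself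
-- (M = k/2); for odd k take M = ⌊k/4⌋ and an explicit prolongation of ℤ/2M by ℤ/t, t = k - 2M.

module Submission where

open import Defs
open import Data.Nat using (ℕ; zero; suc; _≤_; _^_; _/_)

open import Algebra.Definitions using (LeftCancellative; RightCancellative)
open import Data.Bool using (Bool; true; false; if_then_else_)
open import Data.Empty using (⊥; ⊥-elim)
open import Data.Fin as Fin using (Fin; zero; suc; toℕ; fromℕ<; _↑ˡ_; punchOut; combine; funToFin; finToFun)
import Data.Fin.Properties as Fin
open import Data.Integer as ℤ using (ℤ; +_; _+_; _-_; _*_; -_; ∣_∣; _%ℕ_; _/ℕ_)
open import Data.Integer.DivMod using (n%ℕd<d; a≡a%ℕn+[a/ℕn]*n)
open import Data.Integer.Divisibility.Signed
  using (_∣_; divides; ∣ᵤ⇒∣; ∣⇒∣ᵤ; ∣-refl; ∣-trans; ∣m∣n⇒∣m+n; ∣m∣n⇒∣m-n; ∣m⇒∣-m; ∣n⇒∣m*n)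
import Data.Integer.Properties as ℤ
open import Data.Integer.Tactic.RingSolver using (solve-∀)
open import Data.Maybe using (Maybe; just; nothing; maybe′; zipWith; Is-just)
import Data.Maybe.Relation.Unary.Any as Any
import Data.Nat as ℕ
open import Data.Nat.Base using (NonZero; >-nonZero; >-nonZero⁻¹; ≢-nonZero⁻¹)
import Data.Nat.Divisibility as ℕ
open import Data.Nat.DivMod
  using (_%_; m<n⇒m%n≡m; m%n<n; m≡m%n+[m/n]*n; m/n≤m; /-monoˡ-≤; m/n/o≡m/[n*o])
import Data.Nat.Properties as ℕ
import Data.Nat.Tactic.RingSolver as NatSolver
open import Data.Product using (∃; _,_; proj₁; _×_)
open import Data.Sum using (_⊎_; inj₁; inj₂; [_,_]′; map₁)
open import Data.Sum.Properties using (inj₁-injective; inj₂-injective)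
open import Data.Unit using (⊤; tt)
open import Data.Vec.Functional using (Vector; head; tail; updateAt)
open import Function using (_∘_; const; _↔_; Inverse; Injection)
open import Function.Properties.Inverse using (↔-sym; ↔⇒↣)
open import Level using (0ℓ)
open import Relation.Binary using (IsEquivalence; Setoid)
open import Relation.Binary.PropositionalEquality
import Relation.Binary.Reasoning.Setoid as SetoidReasoning
open import Relation.Nullary using (yes; no; contradiction)

ι : ∀ {n} → Fin n → ℤ
ι i = + toℕ i

IsInj₁ : ∀ {A B : Set} → A ⊎ B → Set
IsInj₁ = [ const ⊤ , const ⊥ ]′

infixl 6 _[_]≔_
_[_]≔_ : ∀ {A : Set} {n} → Vector A n → Fin n → A → Vector A n
x [ i ]≔ a = updateAt x i (const a)

map-[]≔ : ∀ {A B : Set} {n} (f : A → B) (x : Vector A n) i a j →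
          f ((x [ i ]≔ a) j) ≡ ((f ∘ x) [ i ]≔ f a) j
map-[]≔ f x zero    a zero    = refl
map-[]≔ f x zero    a (suc j) = refl
map-[]≔ f x (suc i) a zero    = refl
map-[]≔ f x (suc i) a (suc j) = map-[]≔ f (tail x) i a j

-- Congruence modulo t

module Modulo (t : ℕ) .{{_ : NonZero t}} where

  -- A record rather than a synonym for + t ∣ x - y, so that x and y stay inferable.
  infix 4 _≋_
  record _≋_ (x y : ℤ) : Set where
    constructor mk≋
    field t∣x-y : + t ∣ x - y

  ≋-by : ∀ {x y x′ y′} → x - y ≡ x′ - y′ → x ≋ y → x′ ≋ y′
  ≋-by eq (mk≋ t∣x-y) = mk≋ (subst (+ t ∣_) eq t∣x-y)

  ≋-refl : ∀ {x} → x ≋ x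
  ≋-refl {x} = mk≋ (divides (+ 0) (ℤ.+-inverseʳ x))

  ≋-sym : ∀ {x y} → x ≋ y → y ≋ x
  ≋-sym {x} {y} (mk≋ t∣x-y) = mk≋ (subst (+ t ∣_) (negate x y) (∣m⇒∣-m t∣x-y))
    where negate : ∀ x y → - (x - y) ≡ y - x
          negate = solve-∀

  ≋-trans : ∀ {x y z} → x ≋ y → y ≋ z → x ≋ z
  ≋-trans {x} {y} {z} (mk≋ t∣x-y) (mk≋ t∣y-z) =
    mk≋ (subst (+ t ∣_) (ℤ.+-minus-telescope x y z) (∣m∣n⇒∣m+n t∣x-y t∣y-z))

  ≋-isEquivalence : IsEquivalence _≋_
  ≋-isEquivalence = record { refl = ≋-refl ; sym = ≋-sym ; trans = ≋-trans }

  ≋-setoid : Setoid 0ℓ 0ℓ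
  ≋-setoid = record { isEquivalence = ≋-isEquivalence }

  module ≋-Reasoning = SetoidReasoning ≋-setoid

  ≋-multiple : ∀ x q → x + q * + t ≋ x
  ≋-multiple x q = mk≋ (divides q (x+y-x≡y x (q * + t)))
    where x+y-x≡y : ∀ x y → x + y - x ≡ y
          x+y-x≡y = solve-∀

  +-congʳ-≋ : ∀ c {x y} → x ≋ y → x + c ≋ y + c
  +-congʳ-≋ c {x} {y} = ≋-by (shift-difference x y c)
    where shift-difference : ∀ x y c → x - y ≡ (x + c) - (y + c)
          shift-difference = solve-∀

  +-congˡ-≋ : ∀ c {x y} → x ≋ y → c + x ≋ c + y
  +-congˡ-≋ c {x} {y} = ≋-by (shift-difference x y c)
    where shift-difference : ∀ x y c → x - y ≡ (c + x) - (c + y)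
          shift-difference = solve-∀

  +-cancelʳ-≋ : ∀ c {x y} → x + c ≋ y + c → x ≋ y
  +-cancelʳ-≋ c {x} {y} = ≋-by (unshift-difference x y c)
    where unshift-difference : ∀ x y c → (x + c) - (y + c) ≡ x - y
          unshift-difference = solve-∀

  +-cancelˡ-≋ : ∀ c {x y} → c + x ≋ c + y → x ≋ y
  +-cancelˡ-≋ c {x} {y} = ≋-by (unshift-difference x y c)
    where unshift-difference : ∀ x y c → (c + x) - (c + y) ≡ x - y
          unshift-difference = solve-∀

  minus-cancelˡ-≋ : ∀ c {x y} → c - x ≋ c - y → x ≋ y
  minus-cancelˡ-≋ c {x} {y} = ≋-sym ∘ ≋-by (negated-difference x y c)
    where negated-difference : ∀ x y c → (c - x) - (c - y) ≡ y - x
          negated-difference = solve-∀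

  -- For odd t = 1 + 2u, x - y = (x - y) t - u (2x - 2y) is a multiple of t.
  double-cancel-≋ : ∀ u → t ≡ suc (u ℕ.+ u) → ∀ {x y} → + 2 * x ≋ + 2 * y → x ≋ y
  double-cancel-≋ u t≡1+2u {x} {y} (mk≋ t∣2x-2y) =
    mk≋ (subst (+ t ∣_) eq (∣m∣n⇒∣m-n (∣n⇒∣m*n (x - y) ∣-refl) (∣n⇒∣m*n (+ u) t∣2x-2y)))
    where
    t≡1+u+u : + t ≡ + 1 + (+ u + + u)
    t≡1+u+u = trans (cong +_ t≡1+2u) (trans (ℤ.pos-+ 1 (u ℕ.+ u)) (cong (_+_ (+ 1)) (ℤ.pos-+ u u)))
    odd-identity : ∀ x y w → (x - y) * (+ 1 + (w + w)) - w * (+ 2 * x - + 2 * y) ≡ x - y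
    odd-identity = solve-∀
    eq : (x - y) * + t - + u * (+ 2 * x - + 2 * y) ≡ x - y
    eq = trans (cong (λ c → (x - y) * c - + u * (+ 2 * x - + 2 * y)) t≡1+u+u) (odd-identity x y (+ u))

  reduce : ℤ → Fin t
  reduce x = fromℕ< (n%ℕd<d x t)

  ι-reduce : ∀ x → ι (reduce x) ≋ x
  ι-reduce x rewrite Fin.toℕ-fromℕ< (n%ℕd<d x t) =
    subst (+ (x %ℕ t) ≋_) (sym (a≡a%ℕn+[a/ℕn]*n x t)) (≋-sym (≋-multiple (+ (x %ℕ t)) (x /ℕ t)))

  -- t divides the distance of i and j, which is smaller than t.
  ≋⇒≡ : ∀ {i j} → i ℕ.< t → j ℕ.< t → + i ≋ + j → i ≡ j
  ≋⇒≡ {i} {j} i<t j<t (mk≋ t∣i-j) =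
    ℤ.+-injective (ℤ.i-j≡0⇒i≡j (+ i) (+ j) (ℤ.∣i∣≡0⇒i≡0 distance≡0))
    where
    distance<t : ∣ + i - + j ∣ ℕ.< t
    distance<t = ℕ.≤-<-trans
      (subst (ℕ._≤ i ℕ.⊔ j) (cong ∣_∣ (sym (ℤ.[+m]-[+n]≡m⊖n i j))) (ℤ.∣m⊝n∣≤m⊔n i j))
      (ℕ.⊔-lub i<t j<t)
    distance≡0 : ∣ + i - + j ∣ ≡ 0
    distance≡0 = trans (sym (m<n⇒m%n≡m distance<t)) (ℕ.n∣m⇒m%n≡0 _ t (∣⇒∣ᵤ t∣i-j))

  ι-injective-≋ : ∀ {i j : Fin t} → ι i ≋ ι j → i ≡ j
  ι-injective-≋ {i} {j} = Fin.toℕ-injective ∘ ≋⇒≡ (Fin.toℕ<n i) (Fin.toℕ<n j)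

  reduce-cong : ∀ {x y} → x ≋ y → reduce x ≡ reduce y
  reduce-cong {x} {y} x≋y = ι-injective-≋ (≋-trans (ι-reduce x) (≋-trans x≋y (≋-sym (ι-reduce y))))

  reduce-injective : ∀ {x y} → reduce x ≡ reduce y → x ≋ y
  reduce-injective {x} {y} eq =
    ≋-trans (≋-sym (ι-reduce x)) (subst (λ r → ι r ≋ y) (sym eq) (ι-reduce y))

  toℕ-reduce : ∀ {n} → n ℕ.< t → toℕ (reduce (+ n)) ≡ n
  toℕ-reduce {n} n<t = ≋⇒≡ (Fin.toℕ<n (reduce (+ n))) n<t (ι-reduce (+ n))

-- Switching an iterated binary quasigroup

record Switchable (A : Set) : Set₁ where
  infixr 7 _∙_
  field
    _∙_         : A → A → A
    ∙-cancelˡ   : LeftCancellative _≡_ _∙_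
    ∙-cancelʳ   : RightCancellative _≡_ _∙_
    S           : A → Set
    ∙-closed    : ∀ {a b} → S a → S b → S (a ∙ b)
    σ           : A → A
    σ-injective : ∀ {a b} → σ a ≡ σ b → a ≡ b
    σ-noFixedPoint : ∀ {a} → S a → σ a ≢ a
    σ-∙ˡ        : ∀ {a b} → S a → S b → σ a ∙ b ≡ σ (a ∙ b)
    σ-∙ʳ        : ∀ {a b} → S a → S b → a ∙ σ b ≡ σ (a ∙ b)

module Switching {A : Set} (𝒜 : Switchable A) where
  open Switchable 𝒜

  iterate : ∀ n → Vector A (suc n) → A
  iterate zero    x = head x
  iterate (suc n) x = head x ∙ iterate n (tail x)

  iterate-cong : ∀ n {x y} → x ≗ y → iterate n x ≡ iterate n y
  iterate-cong zero    x≗y = x≗y zero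
  iterate-cong (suc n) x≗y = cong₂ _∙_ (x≗y zero) (iterate-cong n (x≗y ∘ suc))

  iterate-cancel : ∀ n x i {a b} → iterate n (x [ i ]≔ a) ≡ iterate n (x [ i ]≔ b) → a ≡ b
  iterate-cancel zero    x zero    eq = eq
  iterate-cancel (suc n) x zero    eq = ∙-cancelʳ _ _ _ eq
  iterate-cancel (suc n) x (suc i) eq = iterate-cancel n (tail x) i (∙-cancelˡ _ _ _ eq)

  iterate-closed : ∀ n {x} → (∀ j → S (x j)) → S (iterate n x)
  iterate-closed zero    x∈S = x∈S zero
  iterate-closed (suc n) x∈S = ∙-closed (x∈S zero) (iterate-closed n (x∈S ∘ suc))

  iterate-σ : ∀ n x i {a} → (∀ j → S ((x [ i ]≔ a) j)) →
              iterate n (x [ i ]≔ σ a) ≡ σ (iterate n (x [ i ]≔ a))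
  iterate-σ zero    x zero    x∈S = refl
  iterate-σ (suc n) x zero    x∈S = σ-∙ˡ (x∈S zero) (iterate-closed n (x∈S ∘ suc))
  iterate-σ (suc n) x (suc i) x∈S = begin
    head x ∙ iterate n (tail x [ i ]≔ σ _)   ≡⟨ cong (head x ∙_) (iterate-σ n (tail x) i (x∈S ∘ suc)) ⟩
    head x ∙ σ (iterate n (tail x [ i ]≔ _)) ≡⟨ σ-∙ʳ (x∈S zero) (iterate-closed n (x∈S ∘ suc)) ⟩
    σ (head x ∙ iterate n (tail x [ i ]≔ _)) ∎
    where open ≡-Reasoning

  switch : ∀ n → (Vector A (suc n) → Bool) → Vector A (suc n) → A
  switch n β x = if β x then σ (iterate n x) else iterate n x

  switch-cong : ∀ n β → (∀ {x y} → x ≗ y → β x ≡ β y) →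
                ∀ {x y} → x ≗ y → switch n β x ≡ switch n β y
  switch-cong n β β-cong x≗y rewrite β-cong x≗y | iterate-cong n x≗y = refl

  switch-separates : ∀ n β β′ {x} → switch n β x ≡ switch n β′ x → (∀ j → S (x j)) → β x ≡ β′ x
  switch-separates n β β′ {x} eq x∈S with β x | β′ x
  ... | false | false = refl
  ... | true  | true  = refl
  ... | false | true  = ⊥-elim (σ-noFixedPoint (iterate-closed n x∈S) (sym eq))
  ... | true  | false = ⊥-elim (σ-noFixedPoint (iterate-closed n x∈S) eq)

  module _ (n : ℕ) (β : Vector A (suc n) → Bool)
           (β⇒S : ∀ {x} → β x ≡ true → ∀ j → S (x j))
           (β-σ : ∀ x i a → β (x [ i ]≔ σ a) ≡ β (x [ i ]≔ a)) where

    switch-collision : ∀ x i {a b} → β (x [ i ]≔ a) ≡ true →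
                       σ (iterate n (x [ i ]≔ a)) ≡ iterate n (x [ i ]≔ b) → β (x [ i ]≔ b) ≡ true
    switch-collision x i {a} {b} βa eq = begin
      β (x [ i ]≔ b)   ≡⟨ cong (β ∘ (x [ i ]≔_)) σa≡b ⟨
      β (x [ i ]≔ σ a) ≡⟨ β-σ x i a ⟩
      β (x [ i ]≔ a)   ≡⟨ βa ⟩
      true             ∎
      where
      open ≡-Reasoning
      σa≡b : σ a ≡ b
      σa≡b = iterate-cancel n x i (trans (iterate-σ n x i (β⇒S βa)) eq)

    switch-cancel : ∀ x i {a b} → switch n β (x [ i ]≔ a) ≡ switch n β (x [ i ]≔ b) → a ≡ b
    switch-cancel x i {a} {b} eq with β (x [ i ]≔ a) in βa | β (x [ i ]≔ b) in βb
    ... | false | false = iterate-cancel n x i eq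
    ... | true  | true  = iterate-cancel n x i (σ-injective eq)
    ... | true  | false = contradiction (trans (sym βb) (switch-collision x i βa eq)) λ ()
    ... | false | true  = contradiction (trans (sym βa) (switch-collision x i βb (sym eq))) λ ()

injective⇒surjective : ∀ {k} (f : Fin k → Fin k) → (∀ {a b} → f a ≡ f b → a ≡ b) →
                       ∀ z → ∃ λ a → f a ≡ z
injective⇒surjective {suc k} f f-injective z with Fin.any? (λ a → f a Fin.≟ z)
... | yes hit = hit
... | no miss = contradiction (Fin.injective⇒≤ punched-injective) (ℕ.<-irrefl refl)
  where
  z≢f : ∀ a → z ≢ f a
  z≢f a z≡fa = miss (a , sym z≡fa)
  punched-injective : ∀ {a b} → punchOut (z≢f a) ≡ punchOut (z≢f b) → a ≡ b
  punched-injective eq = f-injective (Fin.punchOut-injective (z≢f _) (z≢f _) eq)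

cancellative⇒isQuasigroup : ∀ {n k} (f : Op n k) →
  (∀ x i {a b} → f (x [ i ]≔ a) ≡ f (x [ i ]≔ b) → a ≡ b) → IsQuasigroup f
cancellative⇒isQuasigroup f f-cancel i x z
  with injective⇒surjective (λ a → f (x [ i ]≔ a)) (f-cancel x i) z
... | a , fa≡z = a , fa≡z , λ fb≡z → f-cancel x i (trans fa≡z (sym fb≡z))

module Conjugate {A : Set} {k : ℕ} (e : Fin k ↔ A) where
  open Inverse e using (to; from; strictlyInverseˡ)

  conjugate : ∀ {n} → (Vector A n → A) → Op n k
  conjugate G x = from (G (to ∘ x))

  to-injective : ∀ {a b} → to a ≡ to b → a ≡ b
  to-injective = Injection.injective (↔⇒↣ e)

  from-injective : ∀ {a b} → from a ≡ from b → a ≡ b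
  from-injective = Injection.injective (↔⇒↣ (↔-sym e))

  module _ {n} (G : Vector A n → A) (G-cong : ∀ {x y} → x ≗ y → G x ≡ G y) where

    conjugate-isQuasigroup : (∀ x i {a b} → G (x [ i ]≔ a) ≡ G (x [ i ]≔ b) → a ≡ b) →
                             IsQuasigroup (conjugate G)
    conjugate-isQuasigroup G-cancel = cancellative⇒isQuasigroup (conjugate G) λ x i eq →
      to-injective (G-cancel (to ∘ x) i
        (trans (G-cong (sym ∘ map-[]≔ to x i _)) (trans (from-injective eq) (G-cong (map-[]≔ to x i _)))))

    conjugate-reflects : ∀ G′ → (∀ {x y} → x ≗ y → G′ x ≡ G′ y) →
                         conjugate G ≗Op conjugate G′ → ∀ y → G y ≡ G′ y
    conjugate-reflects G′ G′-cong eq y = begin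
      G y                 ≡⟨ G-cong (strictlyInverseˡ ∘ y) ⟨
      G (to ∘ from ∘ y)   ≡⟨ from-injective (eq (from ∘ y)) ⟩
      G′ (to ∘ from ∘ y)  ≡⟨ G′-cong (strictlyInverseˡ ∘ y) ⟩
      G′ y                ∎
      where open ≡-Reasoning

funToFin-cong : ∀ {m n} {f g : Fin m → Fin n} → f ≗ g → funToFin f ≡ funToFin g
funToFin-cong {zero}  f≗g = refl
funToFin-cong {suc m} f≗g = cong₂ combine (f≗g zero) (funToFin-cong (f≗g ∘ suc))

AtLeast-mono : ∀ {m m′ n k} → m ≤ m′ → AtLeast m′ n k → AtLeast m n k
AtLeast-mono m≤m′ (q , q-injective) =
  q ∘ (λ i → Fin.inject≤ i m≤m′) , λ i j eq → Fin.inject≤-injective m≤m′ m≤m′ i j (q-injective _ _ eq)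

atLeast-2^ : ∀ {c n k} (q : (Fin c → Bool) → Q n k) →
             (∀ p p′ → proj₁ (q p) ≗Op proj₁ (q p′) → p ≗ p′) → AtLeast (2 ^ c) n k
atLeast-2^ {c} q q-separates = q ∘ bits , λ N N′ eq → begin
  N                               ≡⟨ Fin.funToFin-finToFin {c} {2} N ⟨
  funToFin (finToFun {2} {c} N)   ≡⟨ funToFin-cong (Injection.injective (↔⇒↣ Fin.2↔Bool) ∘ q-separates _ _ eq) ⟩
  funToFin (finToFun {2} {c} N′)  ≡⟨ Fin.funToFin-finToFin {c} {2} N′ ⟩
  N′                              ∎
  where
  open ≡-Reasoning
  bits : Fin (2 ^ c) → Fin c → Bool
  bits N = Inverse.to Fin.2↔Bool ∘ finToFun N

encode : ∀ {m n} → Vector (Maybe (Fin m)) n → Maybe (Fin (m ^ n))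
encode {n = zero}  v = just zero
encode {n = suc n} v = zipWith combine (head v) (encode (tail v))

encode-cong : ∀ {m n} {v w : Vector (Maybe (Fin m)) n} → v ≗ w → encode v ≡ encode w
encode-cong {n = zero}  v≗w = refl
encode-cong {n = suc n} v≗w = cong₂ (zipWith combine) (v≗w zero) (encode-cong (v≗w ∘ suc))

encode-just : ∀ {m n} (w : Fin n → Fin m) → encode (just ∘ w) ≡ just (funToFin w)
encode-just {n = zero}  w = refl
encode-just {n = suc n} w rewrite encode-just (w ∘ suc) = refl

encode≡just⇒Is-just : ∀ {m n} (v : Vector (Maybe (Fin m)) n) {e} → encode v ≡ just e → ∀ j → Is-just (v j)
encode≡just⇒Is-just {n = suc n} v eq j with v zero in v₀ | encode (tail v) in eq′
encode≡just⇒Is-just {n = suc n} v eq zero    | just _ | just _ = subst Is-just (sym v₀) (Any.just tt)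
encode≡just⇒Is-just {n = suc n} v eq (suc j) | just _ | just _ = encode≡just⇒Is-just (tail v) eq′ j

-- Quasigroups containing ℤ/2M

module Cyclic (M : ℕ) .{{_ : NonZero M}} where

  instance
    M+M-nonZero : NonZero (M ℕ.+ M)
    M+M-nonZero = >-nonZero (ℕ.<-≤-trans (>-nonZero⁻¹ M) (ℕ.m≤m+n M M))

  module ℤ/2M = Modulo (M ℕ.+ M)
  module ℤ/M = Modulo M
  open ℤ/2M using (_≋_; ≋-sym; reduce; ι-reduce; reduce-cong; reduce-injective; ι-injective-≋)

  infixl 6 _⊕_
  _⊕_ : Fin (M ℕ.+ M) → Fin (M ℕ.+ M) → Fin (M ℕ.+ M)
  a ⊕ b = reduce (ι a + ι b)

  half-turn : Fin (M ℕ.+ M) → Fin (M ℕ.+ M)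
  half-turn a = reduce (ι a + + M)

  ⊕-cancelˡ : LeftCancellative _≡_ _⊕_
  ⊕-cancelˡ a b c eq = ι-injective-≋ (ℤ/2M.+-cancelˡ-≋ (ι a) (reduce-injective eq))

  ⊕-cancelʳ : RightCancellative _≡_ _⊕_
  ⊕-cancelʳ a b c eq = ι-injective-≋ (ℤ/2M.+-cancelʳ-≋ (ι a) (reduce-injective eq))

  half-turn-injective : ∀ {a b} → half-turn a ≡ half-turn b → a ≡ b
  half-turn-injective eq = ι-injective-≋ (ℤ/2M.+-cancelʳ-≋ (+ M) (reduce-injective eq))

  half-turn-noFixedPoint : ∀ a → half-turn a ≢ a
  half-turn-noFixedPoint a eq = ≢-nonZero⁻¹ M (ℤ/2M.≋⇒≡ M<2M 0<2M (ℤ/2M.+-cancelˡ-≋ (ι a) a+M≋a+0))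
    where
    M<2M : M ℕ.< M ℕ.+ M
    M<2M = ℕ.m<m+n M (>-nonZero⁻¹ M)
    0<2M : 0 ℕ.< M ℕ.+ M
    0<2M = ℕ.<-trans (>-nonZero⁻¹ M) M<2M
    a+M≋a+0 : ι a + + M ≋ ι a + + 0
    a+M≋a+0 = subst (ι a + + M ≋_) (sym (ℤ.+-identityʳ (ι a)))
                (≋-sym (subst (λ b → ι b ≋ ι a + + M) eq (ι-reduce (ι a + + M))))

  half-turn-⊕ˡ : ∀ a b → half-turn a ⊕ b ≡ half-turn (a ⊕ b)
  half-turn-⊕ˡ a b = reduce-cong (begin
    ι (half-turn a) + ι b  ≈⟨ ℤ/2M.+-congʳ-≋ (ι b) (ι-reduce (ι a + + M)) ⟩
    ι a + + M + ι b        ≡⟨ swap (ι a) (+ M) (ι b) ⟩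
    ι a + ι b + + M        ≈⟨ ℤ/2M.+-congʳ-≋ (+ M) (≋-sym (ι-reduce (ι a + ι b))) ⟩
    ι (a ⊕ b) + + M        ∎)
    where
    open ℤ/2M.≋-Reasoning
    swap : ∀ x y z → x + y + z ≡ x + z + y
    swap = solve-∀

  half-turn-⊕ʳ : ∀ a b → a ⊕ half-turn b ≡ half-turn (a ⊕ b)
  half-turn-⊕ʳ a b = reduce-cong (begin
    ι a + ι (half-turn b)  ≈⟨ ℤ/2M.+-congˡ-≋ (ι a) (ι-reduce (ι b + + M)) ⟩
    ι a + (ι b + + M)      ≡⟨ ℤ.+-assoc (ι a) (ι b) (+ M) ⟨
    ι a + ι b + + M        ≈⟨ ℤ/2M.+-congʳ-≋ (+ M) (≋-sym (ι-reduce (ι a + ι b))) ⟩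
    ι (a ⊕ b) + + M        ∎)
    where open ℤ/2M.≋-Reasoning

  block : Fin (M ℕ.+ M) → Fin M
  block a = ℤ/M.reduce (ι a)

  block-half-turn : ∀ a → block (half-turn a) ≡ block a
  block-half-turn a = ℤ/M.reduce-cong (ℤ/M.≋-trans (mod-M (ι-reduce _)) a+M≋a)
    where
    mod-M : ∀ {x y} → x ≋ y → x ℤ/M.≋ y
    mod-M (ℤ/2M.mk≋ 2M∣x-y) = ℤ/M.mk≋ (∣-trans (∣ᵤ⇒∣ (ℕ.∣m∣n⇒∣m+n ℕ.∣-refl ℕ.∣-refl)) 2M∣x-y)
    a+M≋a : ι a + + M ℤ/M.≋ ι a
    a+M≋a = subst (λ m → ι a + m ℤ/M.≋ ι a) (ℤ.*-identityˡ (+ M)) (ℤ/M.≋-multiple (ι a) (+ 1))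

  block-↑ˡ : ∀ e → block (e ↑ˡ M) ≡ e
  block-↑ˡ e rewrite Fin.toℕ-↑ˡ e M = ℤ/M.ι-injective-≋ (ℤ/M.ι-reduce (ι e))

  record Extension (t : ℕ) : Set where
    infixr 7 _∙_
    field
      _∙_       : Fin (M ℕ.+ M) ⊎ Fin t → Fin (M ℕ.+ M) ⊎ Fin t → Fin (M ℕ.+ M) ⊎ Fin t
      ∙-cancelˡ : LeftCancellative _≡_ _∙_
      ∙-cancelʳ : RightCancellative _≡_ _∙_
      ∙-inj₁    : ∀ a b → inj₁ a ∙ inj₁ b ≡ inj₁ (a ⊕ b)

  module _ {t : ℕ} (E : Extension t) where
    open Extension E

    private
      A : Set
      A = Fin (M ℕ.+ M) ⊎ Fin t

    σ : A → A
    σ = map₁ half-turn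

    switchable : Switchable A
    switchable = record
      { _∙_ = _∙_ ; ∙-cancelˡ = ∙-cancelˡ ; ∙-cancelʳ = ∙-cancelʳ
      ; S = IsInj₁ ; ∙-closed = closed ; σ = σ
      ; σ-injective = σ-injective ; σ-noFixedPoint = σ-noFixedPoint ; σ-∙ˡ = σ-∙ˡ ; σ-∙ʳ = σ-∙ʳ }
      where
      closed : ∀ {a b} → IsInj₁ a → IsInj₁ b → IsInj₁ (a ∙ b)
      closed {inj₁ a} {inj₁ b} _ _ = subst IsInj₁ (sym (∙-inj₁ a b)) tt
      σ-injective : ∀ {a b} → σ a ≡ σ b → a ≡ b
      σ-injective {inj₁ a} {inj₁ b} eq = cong inj₁ (half-turn-injective (inj₁-injective eq))
      σ-injective {inj₂ i} {inj₂ j} eq = eq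
      σ-noFixedPoint : ∀ {a} → IsInj₁ a → σ a ≢ a
      σ-noFixedPoint {inj₁ a} _ = half-turn-noFixedPoint a ∘ inj₁-injective
      σ-∙ˡ : ∀ {a b} → IsInj₁ a → IsInj₁ b → σ a ∙ b ≡ σ (a ∙ b)
      σ-∙ˡ {inj₁ a} {inj₁ b} _ _ = begin
        inj₁ (half-turn a) ∙ inj₁ b  ≡⟨ ∙-inj₁ (half-turn a) b ⟩
        inj₁ (half-turn a ⊕ b)       ≡⟨ cong inj₁ (half-turn-⊕ˡ a b) ⟩
        σ (inj₁ (a ⊕ b))             ≡⟨ cong σ (∙-inj₁ a b) ⟨
        σ (inj₁ a ∙ inj₁ b)          ∎
        where open ≡-Reasoning
      σ-∙ʳ : ∀ {a b} → IsInj₁ a → IsInj₁ b → a ∙ σ b ≡ σ (a ∙ b)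
      σ-∙ʳ {inj₁ a} {inj₁ b} _ _ = begin
        inj₁ a ∙ inj₁ (half-turn b)  ≡⟨ ∙-inj₁ a (half-turn b) ⟩
        inj₁ (a ⊕ half-turn b)       ≡⟨ cong inj₁ (half-turn-⊕ʳ a b) ⟩
        σ (inj₁ (a ⊕ b))             ≡⟨ cong σ (∙-inj₁ a b) ⟨
        σ (inj₁ a ∙ inj₁ b)          ∎
        where open ≡-Reasoning

    open Switching switchable using (switch; switch-cong; switch-separates; switch-cancel)
    open Conjugate (Fin.+↔⊎ {M ℕ.+ M} {t})

    block? : A → Maybe (Fin M)
    block? = [ just ∘ block , const nothing ]′

    block?-σ : ∀ a → block? (σ a) ≡ block? a
    block?-σ (inj₁ a) = cong just (block-half-turn a)
    block?-σ (inj₂ j) = refl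

    -- block? a names the σ-orbit of a; p selects the switched tuples of blocks, numbered by encode.
    switched : ∀ n → (Fin (M ^ suc n) → Bool) → Vector A (suc n) → Bool
    switched n p x = maybe′ p false (encode (block? ∘ x))

    module _ (n : ℕ) (p : Fin (M ^ suc n) → Bool) where

      switched-cong : ∀ {x y} → x ≗ y → switched n p x ≡ switched n p y
      switched-cong x≗y = cong (maybe′ p false) (encode-cong (cong block? ∘ x≗y))

      switched⇒inj₁ : ∀ {x} → switched n p x ≡ true → ∀ j → IsInj₁ (x j)
      switched⇒inj₁ {x} eq j with encode (block? ∘ x) in code
      ... | just e = Is-just⇒IsInj₁ (x j) (encode≡just⇒Is-just (block? ∘ x) code j)
        where
        Is-just⇒IsInj₁ : ∀ a → Is-just (block? a) → IsInj₁ a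
        Is-just⇒IsInj₁ (inj₁ a) _ = tt

      switched-σ : ∀ x i a → switched n p (x [ i ]≔ σ a) ≡ switched n p (x [ i ]≔ a)
      switched-σ x i a = cong (maybe′ p false) (encode-cong λ j → begin
        block? ((x [ i ]≔ σ a) j)                ≡⟨ map-[]≔ block? x i (σ a) j ⟩
        ((block? ∘ x) [ i ]≔ block? (σ a)) j     ≡⟨ cong (λ b → ((block? ∘ x) [ i ]≔ b) j) (block?-σ a) ⟩
        ((block? ∘ x) [ i ]≔ block? a) j         ≡⟨ map-[]≔ block? x i a j ⟨
        block? ((x [ i ]≔ a) j)                  ∎)
        where open ≡-Reasoning

      quasigroup : Q (suc n) (M ℕ.+ M ℕ.+ t)
      quasigroup = conjugate (switch n (switched n p))
                 , conjugate-isQuasigroup _ (switch-cong n _ switched-cong)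
                     (switch-cancel n (switched n p) (λ {x} → switched⇒inj₁ {x}) switched-σ)

    representative : ∀ {n} → Fin (M ^ n) → Vector A n
    representative e j = inj₁ (finToFun e j ↑ˡ M)

    switched-representative : ∀ n p e → switched n p (representative {suc n} e) ≡ p e
    switched-representative n p e = cong (maybe′ p false) (begin
      encode (block? ∘ representative {suc n} e)  ≡⟨ encode-cong (cong just ∘ block-↑ˡ ∘ blocks) ⟩
      encode (just ∘ blocks)                      ≡⟨ encode-just blocks ⟩
      just (funToFin blocks)                      ≡⟨ cong just (Fin.funToFin-finToFin {suc n} {M} e) ⟩
      just e                                      ∎)
      where
      open ≡-Reasoning
      blocks : Fin (suc n) → Fin M
      blocks = finToFun {M} {suc n} e

    quasigroup-separates : ∀ n p p′ → proj₁ (quasigroup n p) ≗Op proj₁ (quasigroup n p′) → p ≗ p′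
    quasigroup-separates n p p′ eq e = begin
      p e                    ≡⟨ switched-representative n p e ⟨
      switched n p x         ≡⟨ switch-separates n (switched n p) (switched n p′) (same-switch x) (λ _ → tt) ⟩
      switched n p′ x        ≡⟨ switched-representative n p′ e ⟩
      p′ e                   ∎
      where
      open ≡-Reasoning
      x : Vector A (suc n)
      x = representative e
      same-switch : ∀ x → switch n (switched n p) x ≡ switch n (switched n p′) x
      same-switch = conjugate-reflects _ (switch-cong n _ (switched-cong n p))
                      _ (switch-cong n _ (switched-cong n p′)) eq

    extension⇒AtLeast : ∀ n → AtLeast (2 ^ (M ^ suc n)) (suc n) (M ℕ.+ M ℕ.+ t)
    extension⇒AtLeast n = atLeast-2^ (quasigroup n) (quasigroup-separates n)

  trivialExtension : Extension 0
  trivialExtension = record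
    { _∙_ = _∙_ ; ∙-cancelˡ = ∙-cancelˡ ; ∙-cancelʳ = ∙-cancelʳ ; ∙-inj₁ = λ _ _ → refl }
    where
    _∙_ : Fin (M ℕ.+ M) ⊎ Fin 0 → Fin (M ℕ.+ M) ⊎ Fin 0 → Fin (M ℕ.+ M) ⊎ Fin 0
    inj₁ a ∙ inj₁ b = inj₁ (a ⊕ b)
    ∙-cancelˡ : LeftCancellative _≡_ _∙_
    ∙-cancelˡ (inj₁ a) (inj₁ b) (inj₁ c) eq = cong inj₁ (⊕-cancelˡ a b c (inj₁-injective eq))
    ∙-cancelʳ : RightCancellative _≡_ _∙_
    ∙-cancelʳ (inj₁ a) (inj₁ b) (inj₁ c) eq = cong inj₁ (⊕-cancelʳ a b c (inj₁-injective eq))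

module OddExtension (M u : ℕ) .{{_ : NonZero M}} (M≤u : M ≤ u) where
  open Cyclic M using (_⊕_; ⊕-cancelˡ; ⊕-cancelʳ; Extension)

  t : ℕ
  t = suc (u ℕ.+ u)

  module ℤ/t = Modulo t
  open ℤ/t using (_≋_; ≋-sym; ≋-by; reduce; reduce-cong; reduce-injective; ι-injective-≋)

  private
    A : Set
    A = Fin (M ℕ.+ M) ⊎ Fin t

  cell : Fin t → Fin t → A
  cell δ v with toℕ δ ℕ.<? M ℕ.+ M
  ... | yes δ<2M = inj₁ (fromℕ< δ<2M)
  ... | no  _    = inj₂ v

  -- Row i carries i + j in column j ∈ ℤ/t, except where j - i is a residue d < 2M: that cell
  -- carries d ∈ ℤ/2M, and the displaced value i + j = 2i + d moves to column d.  Symmetrically,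
  -- column j carries 2j - d in row d.  Since t is odd, doubling is invertible modulo t.
  infixr 7 _∙_
  _∙_ : A → A → A
  inj₁ a ∙ inj₁ b = inj₁ (a ⊕ b)
  inj₁ a ∙ inj₂ j = inj₂ (reduce (+ 2 * ι j - ι a))
  inj₂ i ∙ inj₁ b = inj₂ (reduce (+ 2 * ι i + ι b))
  inj₂ i ∙ inj₂ j = cell (reduce (ι j - ι i)) (reduce (ι i + ι j))

  cell-inj₂ : ∀ δ v {w} → cell δ v ≡ inj₂ w → v ≡ w × (∀ (d : Fin (M ℕ.+ M)) → toℕ δ ≢ toℕ d)
  cell-inj₂ δ v eq with toℕ δ ℕ.<? M ℕ.+ M
  ... | yes _   = contradiction eq λ ()
  ... | no δ≮2M = inj₂-injective eq , λ d δ≡d → δ≮2M (subst (ℕ._< M ℕ.+ M) (sym δ≡d) (Fin.toℕ<n d))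

  cell-cancel : ∀ {δ v δ′ v′} → cell δ v ≡ cell δ′ v′ → δ ≡ δ′ ⊎ v ≡ v′
  cell-cancel {δ} {v} {δ′} {v′} eq with toℕ δ ℕ.<? M ℕ.+ M | toℕ δ′ ℕ.<? M ℕ.+ M
  ... | yes δ<2M | yes δ′<2M = inj₁ (Fin.toℕ-injective (begin
    toℕ δ                ≡⟨ Fin.toℕ-fromℕ< δ<2M ⟨
    toℕ (fromℕ< δ<2M)    ≡⟨ cong toℕ (inj₁-injective eq) ⟩
    toℕ (fromℕ< δ′<2M)   ≡⟨ Fin.toℕ-fromℕ< δ′<2M ⟩
    toℕ δ′               ∎))
    where open ≡-Reasoning
  ... | no _     | no _      = inj₂ (inj₂-injective eq)
  ... | yes _    | no _      = contradiction eq λ ()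
  ... | no _     | yes _     = contradiction eq λ ()

  double-cancel : ∀ {x y} → + 2 * x ≋ + 2 * y → x ≋ y
  double-cancel = ℤ/t.double-cancel-≋ u refl

  small<t : ∀ (d : Fin (M ℕ.+ M)) → toℕ d ℕ.< t
  small<t d = ℕ.<-≤-trans (Fin.toℕ<n d) (ℕ.m≤n⇒m≤1+n (ℕ.+-mono-≤ M≤u M≤u))

  small-injective : ∀ {d d′ : Fin (M ℕ.+ M)} → ι d ≋ ι d′ → d ≡ d′
  small-injective {d} {d′} = Fin.toℕ-injective ∘ ℤ/t.≋⇒≡ (small<t d) (small<t d′)

  residue : ∀ x (d : Fin (M ℕ.+ M)) → x ≋ ι d → toℕ (reduce x) ≡ toℕ d
  residue x d x≋d = trans (cong toℕ (reduce-cong x≋d)) (ℤ/t.toℕ-reduce (small<t d))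

  column-clash : ∀ (a : Fin (M ℕ.+ M)) (i j : Fin t) →
                 cell (reduce (ι j - ι i)) (reduce (ι i + ι j)) ≢ inj₂ (reduce (+ 2 * ι j - ι a))
  column-clash a i j eq with cell-inj₂ (reduce (ι j - ι i)) (reduce (ι i + ι j)) eq
  ... | i+j≡2j-a , avoids = avoids a (residue (ι j - ι i) a j-i≋a)
    where
    identity : ∀ i j a → (i + j) - (+ 2 * j - a) ≡ a - (j - i)
    identity = solve-∀
    j-i≋a : ι j - ι i ≋ ι a
    j-i≋a = ≋-sym (≋-by (identity (ι i) (ι j) (ι a)) (reduce-injective {ι i + ι j} {+ 2 * ι j - ι a} i+j≡2j-a))

  row-clash : ∀ (b : Fin (M ℕ.+ M)) (i j : Fin t) →
              cell (reduce (ι j - ι i)) (reduce (ι i + ι j)) ≢ inj₂ (reduce (+ 2 * ι i + ι b))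
  row-clash b i j eq with cell-inj₂ (reduce (ι j - ι i)) (reduce (ι i + ι j)) eq
  ... | i+j≡2i+b , avoids = avoids b (residue (ι j - ι i) b j-i≋b)
    where
    identity : ∀ i j b → (i + j) - (+ 2 * i + b) ≡ (j - i) - b
    identity = solve-∀
    j-i≋b : ι j - ι i ≋ ι b
    j-i≋b = ≋-by (identity (ι i) (ι j) (ι b)) (reduce-injective {ι i + ι j} {+ 2 * ι i + ι b} i+j≡2i+b)

  ∙-cancelˡ : LeftCancellative _≡_ _∙_
  ∙-cancelˡ (inj₁ a) (inj₁ b) (inj₁ b′) eq = cong inj₁ (⊕-cancelˡ a b b′ (inj₁-injective eq))
  ∙-cancelˡ (inj₁ a) (inj₂ j) (inj₂ j′) eq =
    cong inj₂ (ι-injective-≋ (double-cancel (ℤ/t.+-cancelʳ-≋ (- ι a) (reduce-injective (inj₂-injective eq)))))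
  ∙-cancelˡ (inj₂ i) (inj₁ b) (inj₁ b′) eq =
    cong inj₁ (small-injective (ℤ/t.+-cancelˡ-≋ (+ 2 * ι i) (reduce-injective (inj₂-injective eq))))
  ∙-cancelˡ (inj₂ i) (inj₁ b) (inj₂ j′) eq = contradiction (sym eq) (row-clash b i j′)
  ∙-cancelˡ (inj₂ i) (inj₂ j) (inj₁ b′) eq = contradiction eq (row-clash b′ i j)
  ∙-cancelˡ (inj₂ i) (inj₂ j) (inj₂ j′) eq with cell-cancel eq
  ... | inj₁ δ≡δ′ = cong inj₂ (ι-injective-≋ (ℤ/t.+-cancelʳ-≋ (- ι i) (reduce-injective δ≡δ′)))
  ... | inj₂ v≡v′ = cong inj₂ (ι-injective-≋ (ℤ/t.+-cancelˡ-≋ (ι i) (reduce-injective v≡v′)))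

  ∙-cancelʳ : RightCancellative _≡_ _∙_
  ∙-cancelʳ (inj₁ b) (inj₁ a) (inj₁ a′) eq = cong inj₁ (⊕-cancelʳ b a a′ (inj₁-injective eq))
  ∙-cancelʳ (inj₁ b) (inj₂ i) (inj₂ i′) eq =
    cong inj₂ (ι-injective-≋ (double-cancel (ℤ/t.+-cancelʳ-≋ (ι b) (reduce-injective (inj₂-injective eq)))))
  ∙-cancelʳ (inj₂ j) (inj₁ a) (inj₁ a′) eq =
    cong inj₁ (small-injective (ℤ/t.minus-cancelˡ-≋ (+ 2 * ι j) (reduce-injective (inj₂-injective eq))))
  ∙-cancelʳ (inj₂ j) (inj₁ a) (inj₂ i′) eq = contradiction (sym eq) (column-clash a i′ j)
  ∙-cancelʳ (inj₂ j) (inj₂ i) (inj₁ a′) eq = contradiction eq (column-clash a′ i j)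
  ∙-cancelʳ (inj₂ j) (inj₂ i) (inj₂ i′) eq with cell-cancel eq
  ... | inj₁ δ≡δ′ = cong inj₂ (ι-injective-≋ (ℤ/t.minus-cancelˡ-≋ (ι j) (reduce-injective δ≡δ′)))
  ... | inj₂ v≡v′ = cong inj₂ (ι-injective-≋ (ℤ/t.+-cancelʳ-≋ (ι j) (reduce-injective v≡v′)))

  oddExtension : Extension t
  oddExtension = record
    { _∙_ = _∙_ ; ∙-cancelˡ = ∙-cancelˡ ; ∙-cancelʳ = ∙-cancelʳ ; ∙-inj₁ = λ _ _ → refl }

even-order : ∀ n h .{{_ : NonZero h}} → AtLeast (2 ^ (h ^ suc n)) (suc n) (h ℕ.* 2)
even-order n h = subst (AtLeast _ (suc n)) (h+h+0≡h*2 h)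
  (Cyclic.extension⇒AtLeast h (Cyclic.trivialExtension h) n)
  where h+h+0≡h*2 : ∀ h → h ℕ.+ h ℕ.+ 0 ≡ h ℕ.* 2
        h+h+0≡h*2 = NatSolver.solve-∀

odd-order : ∀ n M r .{{_ : NonZero M}} → AtLeast (2 ^ (M ^ suc n)) (suc n) (suc ((r ℕ.+ M ℕ.* 2) ℕ.* 2))
odd-order n M r = subst (AtLeast _ (suc n)) (size M r)
  (Cyclic.extension⇒AtLeast M (OddExtension.oddExtension M (M ℕ.+ r) (ℕ.m≤m+n M r)) n)
  where size : ∀ M r → M ℕ.+ M ℕ.+ suc (M ℕ.+ r ℕ.+ (M ℕ.+ r)) ≡ suc ((r ℕ.+ M ℕ.* 2) ℕ.* 2)
        size = NatSolver.solve-∀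

proposition2 : (n k : ℕ) → 1 ≤ n → 8 ≤ k → AtLeast (2 ^ ((k / 4) ^ n)) n k
proposition2 (suc n) k _ 8≤k = subst (λ M → AtLeast (2 ^ (M ^ suc n)) (suc n) k) (m/n/o≡m/[n*o] k 2 2)
  (by-parity (k % 2) (m%n<n k 2) (m≡m%n+[m/n]*n k 2))
  where
  h = k / 2
  4≤h : 4 ≤ h
  4≤h = /-monoˡ-≤ 2 8≤k
  by-parity : ∀ r → r ℕ.< 2 → k ≡ r ℕ.+ h ℕ.* 2 → AtLeast (2 ^ ((h / 2) ^ suc n)) (suc n) k
  by-parity 0 _ k≡2h = subst (AtLeast _ (suc n)) (sym k≡2h)
    (AtLeast-mono (ℕ.^-monoʳ-≤ 2 (ℕ.^-monoˡ-≤ (suc n) (m/n≤m h 2)))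
      (even-order n h {{>-nonZero (ℕ.<-≤-trans (ℕ.s≤s ℕ.z≤n) 4≤h)}}))
  by-parity 1 _ k≡1+2h =
    subst (AtLeast _ (suc n)) (sym (trans k≡1+2h (cong (λ h → suc (h ℕ.* 2)) (m≡m%n+[m/n]*n h 2))))
    (odd-order n (h / 2) (h % 2) {{>-nonZero (ℕ.<-≤-trans (ℕ.s≤s ℕ.z≤n) (/-monoˡ-≤ 2 4≤h))}})
  by-parity (suc (suc _)) (ℕ.s≤s (ℕ.s≤s ())) _
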